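{- For every integer $n>3$ there exists an even-regular closed XOR-magic graph of power $n$, and there exists an odd-regular open XOR-magic graph of power $n$.
   Context: All graphs are simple. For a vertex $x$ of a graph, $N(x)$ denotes the set of neighbours of $x$ (open neighbourhood) and $N[x]=N(x)\cup\{x\}$ (closed neighbourhood). A graph is $k$-regular if every vertex has exactly $k$ neighbours; it is odd-regular (even-regular) if it is $k$-regular for some odd (even) $k$. A simple connected graph $G=(V,E)$ with $|V|=2^n$ is an open XOR-magic graph of power $n$ if there is a bijection $\ell:V\to(\mathbb{Z}_2)^n$ such that $\sum_{y\in N(x)}\ell(y)=0$ (the zero vector, sum in $(\mathbb{Z}_2)^n$) for every $x\in V$. It is a closed XOR-magic graph of power $n$ if there is a bijection $\ell:V\to(\mathbb{Z}_2)^n$ such that $\sum_{y\in N[x]}\ell(y)=0$ for every $x\in V$. -}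

module Defs where

open import Data.Nat using (ℕ; _+_; _^_)
open import Data.Bool using (Bool; true; false; _xor_; if_then_else_)
open import Data.Fin using (Fin)
open import Data.Vec using (Vec; replicate; zipWith)
open import Data.List using (List; allFin; foldr; map)
open import Data.Nat.ListAction using (sum)
open import Data.Product using (Σ; _×_; ∃)
open import Relation.Binary.PropositionalEquality using (_≡_)
open import Function.Definitions using (Bijective)

record Graph (N : ℕ) : Set where
  field
    adj    : Fin N → Fin N → Bool
    sym    : ∀ x y → adj x y ≡ adj y x
    irrefl : ∀ x → adj x x ≡ false
open Graph public

data Reach {N : ℕ} (G : Graph N) : Fin N → Fin N → Set where
  here : ∀ {x} → Reach G x x
  step : ∀ {x y z} → adj G x y ≡ true → Reach G y z → Reach G x z

Connected : ∀ {N} → Graph N → Set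
Connected {N} G = ∀ (x y : Fin N) → Reach G x y

degree : ∀ {N} → Graph N → Fin N → ℕ
degree {N} G x = sum (map (λ y → if adj G x y then 1 else 0) (allFin N))

Regular : ∀ {N} → ℕ → Graph N → Set
Regular {N} k G = ∀ (x : Fin N) → degree G x ≡ k

Z2^ : ℕ → Set
Z2^ n = Vec Bool n

zero^ : ∀ n → Z2^ n
zero^ n = replicate n false

_⊕_ : ∀ {n} → Z2^ n → Z2^ n → Z2^ n
_⊕_ = zipWith _xor_

openSum : ∀ {N n} → Graph N → (Fin N → Z2^ n) → Fin N → Z2^ n
openSum {N} {n} G ℓ x =
  foldr (λ y acc → (if adj G x y then ℓ y else zero^ n) ⊕ acc) (zero^ n) (allFin N)

closedSum : ∀ {N n} → Graph N → (Fin N → Z2^ n) → Fin N → Z2^ n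
closedSum G ℓ x = ℓ x ⊕ openSum G ℓ x

-- Vertex set of size 2^n is taken to be Fin (2 ^ n) (w.l.o.g. up to relabelling).
OpenXORMagic : (n : ℕ) → Graph (2 ^ n) → Set
OpenXORMagic n G = Connected G ×
  Σ (Fin (2 ^ n) → Z2^ n) (λ ℓ →
    Bijective _≡_ _≡_ ℓ × (∀ x → openSum G ℓ x ≡ zero^ n))

ClosedXORMagic : (n : ℕ) → Graph (2 ^ n) → Set
ClosedXORMagic n G = Connected G ×
  Σ (Fin (2 ^ n) → Z2^ n) (λ ℓ →
    Bijective _≡_ _≡_ ℓ × (∀ x → closedSum G ℓ x ≡ zero^ n))

{-# OPTIONS --safe #-}
module Submission where

-- Label each vertex by itself in 𝔽₂ⁿ. A list of involutions of 𝔽₂ⁿ whose values at each v are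
-- distinct and different from v generates a simple regular graph, which is open (closed)
-- XOR-magic when these values sum to 0 (to v) for every v. Split 𝔽₂ⁿ = 𝔽₂ʲ × (𝔽₂²)ᵖ. A head is
-- a list of pairs (α, β) of involutions of 𝔽₂ʲ and of 𝔽₂² such that the α's and the β's both
-- satisfy the sum condition; then so do the maps (h, r) ↦ (α h, β r), β acting on each pair of
-- coordinates of r. The extra moves (h, r) ↦ (h, r + eᵢ) and (h + s, r + eᵢ), for a fixed shift
-- s, add 4p to the degree, make the graph connected, and contribute 2p copies of (s, 0) to each
-- sum, that is, nothing. Heads for j = 4, 5 with four (closed) and five (open) maps, found by
-- computer search and checked by evaluation, cover every n ≥ 4 with even resp. odd degree.

open import Defs hiding (sym)

open import Algebra.Definitions using (Involutive)
import Algebra.Properties.CommutativeSemigroup as CommutativeSemigroupProperties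
open import Algebra.Bundles using (CommutativeMonoid)
open import Algebra.Structures using (IsCommutativeMonoid)
open import Data.Bool using (Bool; true; false; not; _xor_; _∨_; if_then_else_; T)
open import Data.Bool.ListAction using (any)
open import Data.Bool.Properties as Bool
  using (xor-assoc; xor-comm; xor-identityˡ; xor-identityʳ; xor-same; T-∨; not-involutive; not-¬)
open import Data.Empty using (⊥-elim)
open import Data.Fin using (Fin; zero; suc; combine; finToFun; funToFin)
open import Data.Fin.Properties as Fin using (2↔Bool; funToFin-finToFin; finToFun-funToFin)
open import Data.List using (List; []; _∷_; map; foldr; allFin; length; filter)
  renaming (_++_ to _++ₗ_)
open import Data.List.Properties
  using (map-∘; map-id; map-cong; map-++; foldr-map; length-map; length-tabulate; length-++)
open import Data.List.Membership.Propositional using (_∈_; find)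
open import Data.List.Membership.Propositional.Properties
  using (∈-map⁺; ∈-map⁻; ∈-filter⁺; ∈-filter⁻; ∈-allFin; ∈-++⁺ˡ; ∈-++⁺ʳ; ∈-++⁻)
open import Data.List.Membership.Propositional.Properties.WithK using (unique∧set⇒bag)
open import Data.List.Relation.Binary.BagAndSetEquality using (∼bag⇒↭)
open import Data.List.Relation.Binary.Disjoint.Propositional using (Disjoint)
open import Data.List.Relation.Binary.Permutation.Propositional using (_↭_; ↭⇒↭ₛ)
import Data.List.Relation.Binary.Permutation.Propositional.Properties as ↭
open import Data.List.Relation.Binary.Permutation.Setoid.Properties using (foldr-commMonoid)
open import Data.List.Relation.Unary.All as All using (All)
open import Data.List.Relation.Unary.All.Properties as Allₚ using (All¬⇒¬Any)
open import Data.List.Relation.Unary.AllPairs as AllPairs using (_∷_)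
import Data.List.Relation.Unary.AllPairs.Properties as AllPairsₚ
open import Data.List.Relation.Unary.Any.Properties using (any⁻)
open import Data.List.Relation.Unary.Unique.Propositional using (Unique)
import Data.List.Relation.Unary.Unique.Propositional.Properties as Uniqueₚ
open import Data.Nat using (ℕ; zero; suc; _+_; _*_; _^_; _<_; s≤s; z≤n)
open import Data.Nat.DivMod using (_mod_)
open import Data.Nat.Divisibility using (_∣_; divides; _∣?_; ∣m∣n⇒∣m+n; ∣m+n∣m⇒∣n)
open import Data.Nat.ListAction using (sum)
open import Data.Nat.Properties using (suc-injective; +-0-isCommutativeMonoid; m^n≢0)
open import Data.Product using (Σ; _×_; _,_; proj₁; proj₂; ∃-syntax)
open import Data.Sum using (inj₁; inj₂)
open import Data.Vec using (Vec; []; _∷_; _++_; take; drop; updateAt; lookup; tabulate)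
open import Data.Vec.Properties
  using (≡-dec; ++-injectiveˡ; ++-injectiveʳ; take++drop≡id; zipWith-assoc; zipWith-comm;
         zipWith-identityˡ; zipWith-identityʳ; zipWith-++; lookup∘tabulate; tabulate∘lookup;
         tabulate-cong; updateAt-updateAt-local; updateAt-id; lookup∘updateAt; lookup∘updateAt′)
open import Function using (_∘_; id; _$_; Inverse; Equivalence; mk⇔)
open import Level using (0ℓ)
open import Function.Definitions using (Bijective)
open import Relation.Binary using (DecidableEquality)
open import Relation.Binary.Construct.Closure.ReflexiveTransitive as Star using (Star; ε; _◅_; _◅◅_)
open import Relation.Binary.PropositionalEquality
open import Relation.Nullary using (¬_; Dec; does; yes; no)
open import Relation.Nullary.Decidable
  using (⌊_⌋; True; map′; _×-dec_; T?; does-⇔; dec-true; dec-false; toWitness; from-no)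
open import Relation.Unary using (Decidable)

private variable
  j m n : ℕ

-- The group 𝔽₂ⁿ

𝟘 : Z2^ n
𝟘 = zero^ _

⊕-assoc : ∀ (x y z : Z2^ n) → (x ⊕ y) ⊕ z ≡ x ⊕ (y ⊕ z)
⊕-assoc = zipWith-assoc xor-assoc

⊕-comm : ∀ (x y : Z2^ n) → x ⊕ y ≡ y ⊕ x
⊕-comm = zipWith-comm xor-comm

⊕-identityˡ : ∀ (x : Z2^ n) → 𝟘 ⊕ x ≡ x
⊕-identityˡ = zipWith-identityˡ xor-identityˡ

⊕-identityʳ : ∀ (x : Z2^ n) → x ⊕ 𝟘 ≡ x
⊕-identityʳ = zipWith-identityʳ xor-identityʳ

⊕-self : ∀ (x : Z2^ n) → x ⊕ x ≡ 𝟘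
⊕-self []      = refl
⊕-self (b ∷ x) = cong₂ _∷_ (xor-same b) (⊕-self x)

⊕-cancelˡ : ∀ (x y : Z2^ n) → x ⊕ (x ⊕ y) ≡ y
⊕-cancelˡ x y = begin
  x ⊕ (x ⊕ y) ≡⟨ ⊕-assoc x x y ⟨
  (x ⊕ x) ⊕ y ≡⟨ cong (_⊕ y) (⊕-self x) ⟩
  𝟘 ⊕ y       ≡⟨ ⊕-identityˡ y ⟩
  y           ∎
  where open ≡-Reasoning

⊕-involutive : ∀ (t : Z2^ n) → Involutive _≡_ (_⊕ t)
⊕-involutive t x = begin
  (x ⊕ t) ⊕ t ≡⟨ ⊕-assoc x t t ⟩
  x ⊕ (t ⊕ t) ≡⟨ cong (x ⊕_) (⊕-self t) ⟩
  x ⊕ 𝟘       ≡⟨ ⊕-identityʳ x ⟩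
  x           ∎
  where open ≡-Reasoning

⊕-isCommutativeMonoid : IsCommutativeMonoid _≡_ (_⊕_ {n}) 𝟘
⊕-isCommutativeMonoid = record
  { isMonoid = record
    { isSemigroup = record
      { isMagma = record { isEquivalence = isEquivalence ; ∙-cong = cong₂ _⊕_ }
      ; assoc   = ⊕-assoc
      }
    ; identity = ⊕-identityˡ , ⊕-identityʳ
    }
  ; comm = ⊕-comm
  }

⊕-commutativeMonoid : ℕ → CommutativeMonoid 0ℓ 0ℓ
⊕-commutativeMonoid n = record { isCommutativeMonoid = ⊕-isCommutativeMonoid {n} }

_≟_ : DecidableEquality (Z2^ n)
_≟_ = ≡-dec Bool._≟_

𝟘-++ : 𝟘 {j + m} ≡ 𝟘 {j} ++ 𝟘 {m}
𝟘-++ {zero}  = refl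
𝟘-++ {suc j} = cong (false ∷_) (𝟘-++ {j})

∑ : List (Z2^ n) → Z2^ n
∑ = foldr _⊕_ 𝟘

∑-++ : ∀ (xs ys : List (Z2^ n)) → ∑ (xs ++ₗ ys) ≡ ∑ xs ⊕ ∑ ys
∑-++ []       ys = sym (⊕-identityˡ (∑ ys))
∑-++ (x ∷ xs) ys = trans (cong (x ⊕_) (∑-++ xs ys)) (sym (⊕-assoc x (∑ xs) (∑ ys)))

module _ {A : Set} where

  ∑-map-⊕ : ∀ (f g : A → Z2^ n) xs → ∑ (map (λ x → f x ⊕ g x) xs) ≡ ∑ (map f xs) ⊕ ∑ (map g xs)
  ∑-map-⊕     f g []       = sym (⊕-identityˡ 𝟘)
  ∑-map-⊕ {n} f g (x ∷ xs) = begin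
    (f x ⊕ g x) ⊕ ∑ (map (λ x → f x ⊕ g x) xs) ≡⟨ cong ((f x ⊕ g x) ⊕_) (∑-map-⊕ f g xs) ⟩
    (f x ⊕ g x) ⊕ (F ⊕ G)                       ≡⟨ interchange (f x) (g x) F G ⟩
    (f x ⊕ F) ⊕ (g x ⊕ G)                       ∎
    where
    open ≡-Reasoning
    open CommutativeSemigroupProperties
      (CommutativeMonoid.commutativeSemigroup (⊕-commutativeMonoid n)) using (interchange)
    F G : Z2^ n
    F = ∑ (map f xs)
    G = ∑ (map g xs)

  ∑-map-++ : ∀ (f : A → Z2^ j) (g : A → Z2^ m) xs →
             ∑ (map (λ x → f x ++ g x) xs) ≡ ∑ (map f xs) ++ ∑ (map g xs)
  ∑-map-++ {j} f g []       = 𝟘-++ {j}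
  ∑-map-++     f g (x ∷ xs) =
    trans (cong ((f x ++ g x) ⊕_) (∑-map-++ f g xs)) (zipWith-++ _xor_ (f x) (g x) _ _)

-- Binary expansions

toBool : Fin 2 → Bool
toBool = Inverse.to 2↔Bool

fromBool : Bool → Fin 2
fromBool = Inverse.from 2↔Bool

-- Most significant bit first.
bits : Fin (2 ^ n) → Z2^ n
bits i = tabulate (toBool ∘ finToFun i)

index : Z2^ n → Fin (2 ^ n)
index v = funToFin (fromBool ∘ lookup v)

funToFin-cong : ∀ {f g : Fin n → Fin m} → (∀ i → f i ≡ g i) → funToFin f ≡ funToFin g
funToFin-cong {zero}  _   = refl
funToFin-cong {suc n} f≗g = cong₂ combine (f≗g zero) (funToFin-cong (f≗g ∘ suc))

bits-index : ∀ (v : Z2^ n) → bits (index v) ≡ v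
bits-index v = begin
  tabulate (toBool ∘ finToFun (funToFin (fromBool ∘ lookup v)))
    ≡⟨ tabulate-cong (cong toBool ∘ finToFun-funToFin (fromBool ∘ lookup v)) ⟩
  tabulate (toBool ∘ fromBool ∘ lookup v)
    ≡⟨ tabulate-cong (Inverse.strictlyInverseˡ 2↔Bool ∘ lookup v) ⟩
  tabulate (lookup v)
    ≡⟨ tabulate∘lookup v ⟩
  v ∎
  where open ≡-Reasoning

index-bits : ∀ (i : Fin (2 ^ n)) → index (bits {n} i) ≡ i
index-bits {n} i = begin
  funToFin (fromBool ∘ lookup (tabulate (toBool ∘ finToFun {2} {n} i)))
    ≡⟨ funToFin-cong {n} (λ k → trans (cong fromBool (lookup∘tabulate _ k))
                                      (Inverse.strictlyInverseʳ 2↔Bool (finToFun i k))) ⟩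
  funToFin (finToFun {2} {n} i)
    ≡⟨ funToFin-finToFin {n} i ⟩
  i ∎
  where open ≡-Reasoning

bits-bijective : Bijective _≡_ _≡_ (bits {n})
bits-bijective {n} =
  (λ {i} {i′} eq → trans (sym (index-bits {n} i)) (trans (cong index eq) (index-bits {n} i′))) ,
  (λ v → index v , λ z≡index → trans (cong bits z≡index) (bits-index v))

all? : ∀ {P : Z2^ n → Set} → Decidable P → Dec (∀ v → P v)
all? {P = P} P? = map′ (λ P-bits v → subst P (bits-index v) (P-bits (index v)))
                       (λ P-all i → P-all (bits i))
                       (Fin.all? (P? ∘ bits))

-- Sums over a neighbourhood

module _ {C : Set} {_∙_ : C → C → C} {ε : C} (isCM : IsCommutativeMonoid _≡_ _∙_ ε) where

  open IsCommutativeMonoid isCM using (identityˡ)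

  foldr-if : ∀ {B : Set} {P : B → Set} (P? : Decidable P) (g : B → C) xs →
             foldr _∙_ ε (map (λ x → if does (P? x) then g x else ε) xs) ≡
             foldr _∙_ ε (map g (filter P? xs))
  foldr-if P? g []       = refl
  foldr-if P? g (x ∷ xs) with does (P? x)
  ... | true  = cong (g x ∙_) (foldr-if P? g xs)
  ... | false = trans (identityˡ _) (foldr-if P? g xs)

  module _ {A : Set} (_≟_ : DecidableEquality A) where

    open import Data.List.Membership.DecPropositional _≟_ using (_∈?_)

    foldr-indicator : ∀ {N} (e : Fin N → A) → Bijective _≡_ _≡_ e →
                      ∀ {L} → Unique L → (g : A → C) →
                      foldr _∙_ ε (map (λ i → if does (e i ∈? L) then g (e i) else ε) (allFin N)) ≡
                      foldr _∙_ ε (map g L)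
    foldr-indicator {N} e (e-injective , e-surjective) {L} L-unique g = begin
      foldr _∙_ ε (map (λ i → if does (e i ∈? L) then g (e i) else ε) (allFin N))
        ≡⟨ foldr-if (λ i → e i ∈? L) (g ∘ e) (allFin N) ⟩
      foldr _∙_ ε (map (g ∘ e) hits)
        ≡⟨ cong (foldr _∙_ ε) (map-∘ hits) ⟩
      foldr _∙_ ε (map g (map e hits))
        ≡⟨ foldr-commMonoid (setoid C) isCM (↭⇒↭ₛ (↭.map⁺ g hits↭L)) ⟩
      foldr _∙_ ε (map g L) ∎
      where
      open ≡-Reasoning
      hits : List (Fin N)
      hits = filter (λ i → e i ∈? L) (allFin N)
      hit⇒member : ∀ {a} → a ∈ map e hits → a ∈ L
      hit⇒member a∈ with i , i∈ , refl ← ∈-map⁻ e a∈ =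
        proj₂ (∈-filter⁻ (λ i → e i ∈? L) {xs = allFin N} i∈)
      member⇒hit : ∀ {a} → a ∈ L → a ∈ map e hits
      member⇒hit {a} a∈ with i , ei≡a ← e-surjective a =
        subst (_∈ map e hits) (ei≡a refl)
          (∈-map⁺ e (∈-filter⁺ (λ i → e i ∈? L) (∈-allFin i) (subst (_∈ L) (sym (ei≡a refl)) a∈)))
      hits↭L : map e hits ↭ L
      hits↭L = ∼bag⇒↭ (unique∧set⇒bag
        (Uniqueₚ.map⁺ e-injective (Uniqueₚ.filter⁺ (λ i → e i ∈? L) (Uniqueₚ.allFin⁺ N)))
        L-unique
        (mk⇔ hit⇒member member⇒hit))

sum-ones : ∀ {A : Set} (xs : List A) → sum (map (λ _ → 1) xs) ≡ length xs
sum-ones []       = refl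
sum-ones (_ ∷ xs) = cong suc (sum-ones xs)

-- Graphs generated by involutions

module _ {A : Set} where

  neighbours : List (A → A) → A → List A
  neighbours fs v = map (_$ v) fs

  Step : List (A → A) → A → A → Set
  Step fs v w = w ∈ neighbours fs v

  Walk : List (A → A) → A → A → Set
  Walk fs = Star (Step fs)

  ∈⇒step : ∀ {fs f} v → f ∈ fs → Step fs v (f v)
  ∈⇒step v = ∈-map⁺ (_$ v)

  step-sym : ∀ {fs} → All (Involutive _≡_) fs → ∀ {v w} → Step fs v w → Step fs w v
  step-sym {fs} involutive {v} s with f , f∈ , refl ← ∈-map⁻ (_$ v) s =
    subst (Step fs (f v)) (All.lookup involutive f∈ v) (∈⇒step (f v) f∈)

  neighbours-map : ∀ {K : Set} (F : K → A → A) ks v → neighbours (map F ks) v ≡ map (λ k → F k v) ks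
  neighbours-map F ks v = sym (map-∘ ks)

walk-map : ∀ {A B : Set} {fs : List (A → A)} {gs : List (B → B)} (ι : A → B) →
           (∀ {f} → f ∈ fs → ∃[ g ] g ∈ gs × ∀ x → g (ι x) ≡ ι (f x)) →
           ∀ {x y} → Walk fs x y → Walk gs (ι x) (ι y)
walk-map {fs = fs} {gs} ι simulate = Star.gmap ι step-map
  where
  step-map : ∀ {x y} → Step fs x y → Step gs (ι x) (ι y)
  step-map {x} s with f , f∈ , refl ← ∈-map⁻ (_$ x) s
                 with g , g∈ , g∘ι ← simulate f∈ =
    subst (Step gs (ι x)) (g∘ι x) (∈⇒step (ι x) g∈)

module _ {A : Set} (_≟_ : DecidableEquality A) (fs : List (A → A)) (target : A) where

  reachesWithin : ℕ → A → Bool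
  reachesWithin zero    a = ⌊ a ≟ target ⌋
  reachesWithin (suc d) a = ⌊ a ≟ target ⌋ ∨ any (λ f → reachesWithin d (f a)) fs

  reachesWithin-sound : ∀ d a → T (reachesWithin d a) → Walk fs a target
  reachesWithin-sound zero    a found = subst (Walk fs a) (toWitness {a? = a ≟ target} found) ε
  reachesWithin-sound (suc d) a found with Equivalence.to T-∨ found
  ... | inj₁ at-target = subst (Walk fs a) (toWitness {a? = a ≟ target} at-target) ε
  ... | inj₂ onwards  with f , f∈ , found′ ← find (any⁻ _ fs onwards) =
    ∈⇒step a f∈ ◅ reachesWithin-sound d (f a) found′

data Nbhd : Set where
  openN closedN : Nbhd

centre : Nbhd → Z2^ n → Z2^ n
centre openN   _ = 𝟘
centre closedN v = v

Magic : Nbhd → List (Z2^ n → Z2^ n) → Set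
Magic κ fs = ∀ v → centre κ v ⊕ ∑ (neighbours fs v) ≡ 𝟘

XORMagic : Nbhd → (n : ℕ) → Graph (2 ^ n) → Set
XORMagic openN   = OpenXORMagic
XORMagic closedN = ClosedXORMagic

module InvolutionGraph {n} (fs : List (Z2^ n → Z2^ n)) (involutive : All (Involutive _≡_) fs)
                       (simple : ∀ v → Unique (v ∷ neighbours fs v)) where

  open import Data.List.Membership.DecPropositional (_≟_ {n}) using (_∈?_)

  graph : Graph (2 ^ n)
  graph = record
    { adj    = λ x y → does (bits y ∈? neighbours fs (bits x))
    ; sym    = λ x y → does-⇔ (mk⇔ (step-sym involutive) (step-sym involutive))
                               (bits y ∈? neighbours fs (bits x)) (bits x ∈? neighbours fs (bits y))
    ; irrefl = λ x → dec-false (bits x ∈? _) (All¬⇒¬Any (AllPairs.head (simple (bits x))))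
    }

  step⇒adj : ∀ {v w} → Step fs v w → adj graph (index v) (index w) ≡ true
  step⇒adj {v} {w} s =
    dec-true (bits (index w) ∈? _) (subst₂ (Step fs) (sym (bits-index v)) (sym (bits-index w)) s)

  walk⇒reach : ∀ {v w} → Walk fs v w → Reach graph (index v) (index w)
  walk⇒reach ε        = here
  walk⇒reach (s ◅ ss) = step (step⇒adj s) (walk⇒reach ss)

  connected : ∀ v₀ → (∀ v → Walk fs v v₀) → Connected graph
  connected v₀ walks x y = subst₂ (Reach graph) (index-bits {n} x) (index-bits {n} y)
    (walk⇒reach (walks (bits x) ◅◅ Star.reverse (step-sym involutive) (walks (bits y))))

  openSum-graph : ∀ x → openSum graph bits x ≡ ∑ (neighbours fs (bits x))
  openSum-graph x = begin
    openSum graph bits x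
      ≡⟨ foldr-map _⊕_ _ 𝟘 (allFin (2 ^ n)) ⟨
    ∑ (map (λ y → if adj graph x y then bits y else 𝟘) (allFin (2 ^ n)))
      ≡⟨ foldr-indicator ⊕-isCommutativeMonoid _≟_ bits bits-bijective
                         (AllPairs.tail (simple (bits x))) id ⟩
    ∑ (map id (neighbours fs (bits x)))
      ≡⟨ cong ∑ (map-id (neighbours fs (bits x))) ⟩
    ∑ (neighbours fs (bits x)) ∎
    where open ≡-Reasoning

  degree-graph : ∀ x → degree graph x ≡ length fs
  degree-graph x = begin
    degree graph x
      ≡⟨ foldr-indicator +-0-isCommutativeMonoid _≟_ bits bits-bijective
                         (AllPairs.tail (simple (bits x))) (λ _ → 1) ⟩
    sum (map (λ _ → 1) (neighbours fs (bits x)))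
      ≡⟨ sum-ones (neighbours fs (bits x)) ⟩
    length (neighbours fs (bits x))
      ≡⟨ length-map (_$ bits x) fs ⟩
    length fs ∎
    where open ≡-Reasoning

  xorMagic : ∀ κ → Magic κ fs → (∀ v → Walk fs v 𝟘) → XORMagic κ n graph
  xorMagic openN magic walks =
    connected 𝟘 walks , bits , bits-bijective ,
    λ x → trans (openSum-graph x) (trans (sym (⊕-identityˡ _)) (magic (bits x)))
  xorMagic closedN magic walks =
    connected 𝟘 walks , bits , bits-bijective ,
    λ x → trans (cong (bits x ⊕_) (openSum-graph x)) (magic (bits x))

-- Products 𝔽₂ʲ × 𝔽₂ᵐ

module _ {A : Set} where

  take-++ : ∀ (h : Vec A j) (r : Vec A m) → take j (h ++ r) ≡ h
  take-++ []      r = refl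
  take-++ (a ∷ h) r = cong (a ∷_) (take-++ h r)

  drop-++ : ∀ (h : Vec A j) (r : Vec A m) → drop j (h ++ r) ≡ r
  drop-++ []      r = refl
  drop-++ (a ∷ h) r = drop-++ h r

  ∀-split : ∀ {P : Vec A (j + m) → Set} → (∀ h r → P (h ++ r)) → ∀ v → P v
  ∀-split {j} {P = P} P-split v = subst P (take++drop≡id j v) (P-split (take j v) (drop j v))

  unique-++-prefix : ∀ {K : Set} (f : K → Vec A j) (g : K → Vec A m) ks →
                     Unique (map f ks) → Unique (map (λ k → f k ++ g k) ks)
  unique-++-prefix f g ks f-unique =
    AllPairsₚ.map⁺ (AllPairs.map (λ f≢ eq → f≢ (++-injectiveˡ _ _ eq)) (AllPairsₚ.map⁻ f-unique))

  disjoint-++-prefix : ∀ {X Y : Set} {xs : List X} {ys : List Y}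
                       (f : X → Vec A j) (g : X → Vec A m) (f′ : Y → Vec A j) (g′ : Y → Vec A m) →
                       (∀ {x y} → x ∈ xs → y ∈ ys → f x ≢ f′ y) →
                       Disjoint (map (λ x → f x ++ g x) xs) (map (λ y → f′ y ++ g′ y) ys)
  disjoint-++-prefix f g f′ g′ separated (v∈xs , v∈ys)
    with x , x∈ , refl ← ∈-map⁻ (λ x → f x ++ g x) v∈xs
    with y , y∈ , eq   ← ∈-map⁻ (λ y → f′ y ++ g′ y) v∈ys =
    separated x∈ y∈ (++-injectiveˡ _ _ eq)

  disjoint-++ˡ : ∀ {xs ys zs : List A} → Disjoint xs zs → Disjoint ys zs → Disjoint (xs ++ₗ ys) zs
  disjoint-++ˡ {xs} xs#zs ys#zs (v∈xs++ys , v∈zs) with ∈-++⁻ xs v∈xs++ys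
  ... | inj₁ v∈xs = xs#zs (v∈xs , v∈zs)
  ... | inj₂ v∈ys = ys#zs (v∈ys , v∈zs)

_⊗_ : (Z2^ j → Z2^ j) → (Z2^ m → Z2^ m) → Z2^ (j + m) → Z2^ (j + m)
_⊗_ {j} f g v = f (take j v) ++ g (drop j v)

⊗-++ : ∀ (f : Z2^ j → Z2^ j) (g : Z2^ m → Z2^ m) h r → (f ⊗ g) (h ++ r) ≡ f h ++ g r
⊗-++ f g h r = cong₂ (λ h′ r′ → f h′ ++ g r′) (take-++ h r) (drop-++ h r)

⊗-involutive : ∀ {f : Z2^ j → Z2^ j} {g : Z2^ m → Z2^ m} →
               Involutive _≡_ f → Involutive _≡_ g → Involutive _≡_ (f ⊗ g)
⊗-involutive {f = f} {g} f-involutive g-involutive = ∀-split λ h r → begin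
  (f ⊗ g) ((f ⊗ g) (h ++ r)) ≡⟨ cong (f ⊗ g) (⊗-++ f g h r) ⟩
  (f ⊗ g) (f h ++ g r)       ≡⟨ ⊗-++ f g (f h) (g r) ⟩
  f (f h) ++ g (g r)         ≡⟨ cong₂ _++_ (f-involutive h) (g-involutive r) ⟩
  h ++ r                     ∎
  where open ≡-Reasoning

neighbours-⊗ : ∀ {K : Set} (f : K → Z2^ j → Z2^ j) (g : K → Z2^ m → Z2^ m) ks h r →
               neighbours (map (λ k → f k ⊗ g k) ks) (h ++ r) ≡ map (λ k → f k h ++ g k r) ks
neighbours-⊗ f g ks h r =
  trans (neighbours-map _ ks (h ++ r)) (map-cong (λ k → ⊗-++ (f k) (g k) h r) ks)

centre-++ : ∀ κ (h : Z2^ j) (r : Z2^ m) → centre κ (h ++ r) ≡ centre κ h ++ centre κ r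
centre-++ {j} openN   h r = 𝟘-++ {j}
centre-++     closedN h r = refl

magic-++ : ∀ {κ} {gs fs : List (Z2^ n → Z2^ n)} → Magic openN gs → Magic κ fs → Magic κ (gs ++ₗ fs)
magic-++ {κ = κ} {gs} {fs} gs-magic fs-magic v = begin
  centre κ v ⊕ ∑ (neighbours (gs ++ₗ fs) v)
    ≡⟨ cong (λ L → centre κ v ⊕ ∑ L) (map-++ (_$ v) gs fs) ⟩
  centre κ v ⊕ ∑ (neighbours gs v ++ₗ neighbours fs v)
    ≡⟨ cong (centre κ v ⊕_) (∑-++ (neighbours gs v) (neighbours fs v)) ⟩
  centre κ v ⊕ (∑ (neighbours gs v) ⊕ ∑ (neighbours fs v))
    ≡⟨ cong (λ x → centre κ v ⊕ (x ⊕ ∑ (neighbours fs v))) ∑gs≡𝟘 ⟩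
  centre κ v ⊕ (𝟘 ⊕ ∑ (neighbours fs v))
    ≡⟨ cong (centre κ v ⊕_) (⊕-identityˡ _) ⟩
  centre κ v ⊕ ∑ (neighbours fs v)
    ≡⟨ fs-magic v ⟩
  𝟘 ∎
  where
  open ≡-Reasoning
  ∑gs≡𝟘 : ∑ (neighbours gs v) ≡ 𝟘
  ∑gs≡𝟘 = trans (sym (⊕-identityˡ _)) (gs-magic v)

magic-⊗ : ∀ {κ} {K : Set} (ks : List K) (f : K → Z2^ j → Z2^ j) (g : K → Z2^ m → Z2^ m) →
          Magic κ (map f ks) → Magic κ (map g ks) → Magic κ (map (λ k → f k ⊗ g k) ks)
magic-⊗ {j} {m} {κ} {K} ks f g f-magic g-magic = ∀-split λ h r → begin
  centre κ (h ++ r) ⊕ ∑ (neighbours (map (λ k → f k ⊗ g k) ks) (h ++ r))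
    ≡⟨ cong₂ (λ c L → c ⊕ ∑ L) (centre-++ κ h r) (neighbours-⊗ f g ks h r) ⟩
  (centre κ h ++ centre κ r) ⊕ ∑ (map (λ k → f k h ++ g k r) ks)
    ≡⟨ cong ((centre κ h ++ centre κ r) ⊕_) (∑-map-++ (λ k → f k h) (λ k → g k r) ks) ⟩
  (centre κ h ++ centre κ r) ⊕ (∑ (map (λ k → f k h) ks) ++ ∑ (map (λ k → g k r) ks))
    ≡⟨ zipWith-++ _xor_ (centre κ h) (centre κ r) _ _ ⟩
  (centre κ h ⊕ ∑ (map (λ k → f k h) ks)) ++ (centre κ r ⊕ ∑ (map (λ k → g k r) ks))
    ≡⟨ cong₂ _++_ (magic-at f f-magic h) (magic-at g g-magic r) ⟩
  𝟘 {j} ++ 𝟘 {m}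
    ≡⟨ 𝟘-++ {j} ⟨
  𝟘 ∎
  where
  open ≡-Reasoning
  magic-at : ∀ {i} (F : K → Z2^ i → Z2^ i) → Magic κ (map F ks) →
             ∀ x → centre κ x ⊕ ∑ (map (λ k → F k x) ks) ≡ 𝟘
  magic-at F F-magic x =
    trans (cong (λ L → centre κ x ⊕ ∑ L) (sym (neighbours-map F ks x))) (F-magic x)

magic-Z2^0 : ∀ κ (fs : List (Z2^ 0 → Z2^ 0)) → Magic κ fs
magic-Z2^0 κ fs v with centre κ v ⊕ ∑ (neighbours fs v)
... | [] = refl

-- Bit flips

flip-at : Fin m → Z2^ m → Z2^ m
flip-at i v = updateAt v i not

flips : ∀ m → List (Z2^ m → Z2^ m)
flips m = map flip-at (allFin m)

length-flips : ∀ m → length (flips m) ≡ m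
length-flips m = trans (length-map flip-at (allFin m)) (length-tabulate id)

flip-at-involutive : ∀ (i : Fin m) → Involutive _≡_ (flip-at i)
flip-at-involutive i v =
  trans (updateAt-updateAt-local i v (not-involutive (lookup v i))) (updateAt-id i v)

flips-involutive : All (Involutive _≡_) (flips m)
flips-involutive {m} = Allₚ.map⁺ (All.universal flip-at-involutive (allFin m))

flip-at-changes : ∀ (i : Fin m) v → v ≢ flip-at i v
flip-at-changes i v v≡ = not-¬ refl (trans (cong (λ w → lookup w i) v≡) (lookup∘updateAt i v))

flip-at-injective : ∀ (v : Z2^ m) {i i′} → flip-at i v ≡ flip-at i′ v → i ≡ i′
flip-at-injective v {i} {i′} eq with i Fin.≟ i′
... | yes i≡i′ = i≡i′
... | no  i≢i′ = ⊥-elim (not-¬ refl (begin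
  lookup v i              ≡⟨ lookup∘updateAt′ i i′ i≢i′ v ⟨
  lookup (flip-at i′ v) i ≡⟨ cong (λ w → lookup w i) eq ⟨
  lookup (flip-at i v) i  ≡⟨ lookup∘updateAt i v ⟩
  not (lookup v i)        ∎))
  where open ≡-Reasoning

flips-simple : ∀ (v : Z2^ m) → Unique (v ∷ neighbours (flips m) v)
flips-simple {m} v = subst (λ L → Unique (v ∷ L)) (sym (neighbours-map flip-at (allFin m) v))
  (Allₚ.map⁺ (All.universal (λ i → flip-at-changes i v) (allFin m)) ∷
   Uniqueₚ.map⁺ (flip-at-injective v) (Uniqueₚ.allFin⁺ m))

flips-walk : ∀ (v : Z2^ m) → Walk (flips m) v 𝟘
flips-walk []      = ε
flips-walk (b ∷ v) = walk-map (b ∷_) extend (flips-walk v) ◅◅ clear b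
  where
  extend : ∀ {f} → f ∈ flips _ → ∃[ g ] g ∈ flips _ × ∀ x → g (b ∷ x) ≡ b ∷ f x
  extend f∈ with i , _ , refl ← ∈-map⁻ flip-at f∈ =
    flip-at (suc i) , ∈-map⁺ flip-at (∈-allFin (suc i)) , λ _ → refl
  clear : ∀ b → Walk (flips _) (b ∷ 𝟘) 𝟘
  clear false = ε
  clear true  = ∈⇒step (true ∷ 𝟘) (∈-map⁺ flip-at (∈-allFin zero)) ◅ ε

-- Pairs of coordinates

twice : ℕ → ℕ
twice zero    = zero
twice (suc p) = suc (suc (twice p))

2∣twice+twice : ∀ p → 2 ∣ twice p + twice p
2∣twice+twice p = ∣m∣n⇒∣m+n 2∣twice 2∣twice
  where
  twice≡*2 : ∀ p → twice p ≡ p * 2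
  twice≡*2 zero    = refl
  twice≡*2 (suc p) = cong (2 +_) (twice≡*2 p)
  2∣twice : 2 ∣ twice p
  2∣twice = divides p (twice≡*2 p)

∑-const-twice : ∀ {A : Set} (c : Z2^ n) (xs : List A) p → length xs ≡ twice p →
                ∑ (map (λ _ → c) xs) ≡ 𝟘
∑-const-twice c []           zero    _  = refl
∑-const-twice c (_ ∷ _ ∷ xs) (suc p) eq =
  trans (⊕-cancelˡ c _) (∑-const-twice c xs p (suc-injective (suc-injective eq)))

pairwise : (Z2^ 2 → Z2^ 2) → ∀ p → Z2^ (twice p) → Z2^ (twice p)
pairwise β zero    = id
pairwise β (suc p) = β ⊗ pairwise β p

pairwise-involutive : ∀ {β} → Involutive _≡_ β → ∀ p → Involutive _≡_ (pairwise β p)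
pairwise-involutive     β-involutive zero    = λ _ → refl
pairwise-involutive {β} β-involutive (suc p) =
  ⊗-involutive {f = β} {g = pairwise β p} β-involutive (pairwise-involutive {β} β-involutive p)

pairwise-magic : ∀ {κ} {K : Set} (ks : List K) (β : K → Z2^ 2 → Z2^ 2) → Magic κ (map β ks) →
                 ∀ p → Magic κ (map (λ k → pairwise (β k) p) ks)
pairwise-magic {κ} ks β β-magic zero    = magic-Z2^0 κ (map (λ k → pairwise (β k) zero) ks)
pairwise-magic {κ} ks β β-magic (suc p) =
  magic-⊗ {κ = κ} ks β (λ k → pairwise (β k) p) β-magic (pairwise-magic {κ} ks β β-magic p)

-- Heads and the graphs built on them

record Head (κ : Nbhd) (j : ℕ) : Set where
  field
    maps       : List ((Z2^ j → Z2^ j) × (Z2^ 2 → Z2^ 2))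
    shift      : Z2^ j
    involutive : All (λ (α , β) → Involutive _≡_ α × Involutive _≡_ β) maps
    separated  : ∀ h → Unique (h ∷ (h ⊕ shift) ∷ neighbours (map proj₁ maps) h)
    magicˡ     : Magic κ (map proj₁ maps)
    magicʳ     : Magic κ (map proj₂ maps)
    walks      : ∀ h → Walk (map proj₁ maps) h 𝟘

module Construction {κ j} (H : Head κ j) (p : ℕ) where

  open Head H

  V : Set
  V = Z2^ (j + twice p)

  tailFlips : List (Z2^ (twice p) → Z2^ (twice p))
  tailFlips = flips (twice p)

  length-map-tailFlips : ∀ {B : Set} (F : (Z2^ (twice p) → Z2^ (twice p)) → B) →
                         length (map F tailFlips) ≡ twice p
  length-map-tailFlips F = trans (length-map F tailFlips) (length-flips (twice p))

  flipPart : List (V → V)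
  flipPart = map (λ f → id ⊗ f) tailFlips ++ₗ map (λ f → (_⊕ shift) ⊗ f) tailFlips

  productPart : List (V → V)
  productPart = map (λ (α , β) → α ⊗ pairwise β p) maps

  family : List (V → V)
  family = flipPart ++ₗ productPart

  neighbours-flipPart : ∀ h r → neighbours flipPart (h ++ r) ≡
                        map (h ++_) (neighbours tailFlips r) ++ₗ
                        map ((h ⊕ shift) ++_) (neighbours tailFlips r)
  neighbours-flipPart h r = begin
    neighbours flipPart (h ++ r)
      ≡⟨ map-++ (_$ (h ++ r)) (map (λ f → id ⊗ f) tailFlips) _ ⟩
    neighbours (map (λ f → id ⊗ f) tailFlips) (h ++ r) ++ₗ
    neighbours (map (λ f → (_⊕ shift) ⊗ f) tailFlips) (h ++ r)
      ≡⟨ cong₂ _++ₗ_ (neighbours-⊗ (λ _ → id) id tailFlips h r)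
                     (neighbours-⊗ (λ _ → _⊕ shift) id tailFlips h r) ⟩
    map (λ f → h ++ f r) tailFlips ++ₗ map (λ f → (h ⊕ shift) ++ f r) tailFlips
      ≡⟨ cong₂ _++ₗ_ (map-∘ tailFlips) (map-∘ tailFlips) ⟩
    map (h ++_) (neighbours tailFlips r) ++ₗ map ((h ⊕ shift) ++_) (neighbours tailFlips r) ∎
    where open ≡-Reasoning

  module Neighbourhood (h : Z2^ j) (r : Z2^ (twice p)) where

    sameHead shiftedHead newHead : List V
    sameHead    = map (h ++_) (r ∷ neighbours tailFlips r)
    shiftedHead = map ((h ⊕ shift) ++_) (neighbours tailFlips r)
    newHead     = map (λ k → proj₁ k h ++ pairwise (proj₂ k) p r) maps

    neighbours-family : (h ++ r) ∷ neighbours family (h ++ r) ≡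
                        (sameHead ++ₗ shiftedHead) ++ₗ newHead
    neighbours-family = cong ((h ++ r) ∷_) (trans (map-++ (_$ (h ++ r)) flipPart productPart)
      (cong₂ _++ₗ_ (neighbours-flipPart h r)
                   (neighbours-⊗ proj₁ (λ k → pairwise (proj₂ k) p) maps h r)))

    separated′ : Unique (h ∷ (h ⊕ shift) ∷ map (λ k → proj₁ k h) maps)
    separated′ =
      subst (λ L → Unique (h ∷ (h ⊕ shift) ∷ L)) (neighbours-map proj₁ maps h) (separated h)

    h≢h⊕shift : h ≢ h ⊕ shift
    h≢h⊕shift = All.head (AllPairs.head separated′)

    h≢head : ∀ {k} → k ∈ maps → h ≢ proj₁ k h
    h≢head = All.lookup (Allₚ.map⁻ (All.tail (AllPairs.head separated′)))

    h⊕shift≢head : ∀ {k} → k ∈ maps → h ⊕ shift ≢ proj₁ k h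
    h⊕shift≢head = All.lookup (Allₚ.map⁻ (AllPairs.head (AllPairs.tail separated′)))

    unique : Unique ((sameHead ++ₗ shiftedHead) ++ₗ newHead)
    unique =
      Uniqueₚ.++⁺ {xs = sameHead ++ₗ shiftedHead}
        (Uniqueₚ.++⁺ {xs = sameHead}
          (Uniqueₚ.map⁺ (++-injectiveʳ _ _) (flips-simple r))
          (Uniqueₚ.map⁺ (++-injectiveʳ _ _) (AllPairs.tail (flips-simple r)))
          (disjoint-++-prefix (λ _ → h) id (λ _ → h ⊕ shift) id (λ _ _ → h≢h⊕shift)))
        (unique-++-prefix (λ k → proj₁ k h) (λ k → pairwise (proj₂ k) p r) maps
                          (AllPairs.tail (AllPairs.tail separated′)))
        (disjoint-++ˡ {xs = sameHead}
          (disjoint-++-prefix (λ _ → h) id (λ k → proj₁ k h) _ (λ _ → h≢head))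
          (disjoint-++-prefix (λ _ → h ⊕ shift) id (λ k → proj₁ k h) _ (λ _ → h⊕shift≢head)))

  family-simple : ∀ v → Unique (v ∷ neighbours family v)
  family-simple = ∀-split λ h r →
    subst Unique (sym (Neighbourhood.neighbours-family h r)) (Neighbourhood.unique h r)

  family-involutive : All (Involutive _≡_) family
  family-involutive =
    Allₚ.++⁺ (Allₚ.++⁺ (with-flips id (λ _ → refl)) (with-flips (_⊕ shift) (⊕-involutive shift)))
             (Allₚ.map⁺ (All.map (λ {(α , β)} (α-involutive , β-involutive) →
                                    ⊗-involutive {f = α} {g = pairwise β p} α-involutive
                                                 (pairwise-involutive {β} β-involutive p))
                                 involutive))
    where
    with-flips : ∀ a → Involutive _≡_ a → All (Involutive _≡_) (map (λ f → a ⊗ f) tailFlips)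
    with-flips a a-involutive =
      Allₚ.map⁺ (All.map (λ {f} → ⊗-involutive {f = a} {g = f} a-involutive) flips-involutive)

  flipPart-magic : Magic openN flipPart
  flipPart-magic = ∀-split λ h r → begin
    𝟘 ⊕ ∑ (neighbours flipPart (h ++ r))
      ≡⟨ ⊕-identityˡ _ ⟩
    ∑ (neighbours flipPart (h ++ r))
      ≡⟨ cong ∑ (neighbours-flipPart h r) ⟩
    ∑ (map (h ++_) (N r) ++ₗ map ((h ⊕ shift) ++_) (N r))
      ≡⟨ ∑-++ (map (h ++_) (N r)) _ ⟩
    ∑ (map (h ++_) (N r)) ⊕ ∑ (map ((h ⊕ shift) ++_) (N r))
      ≡⟨ ∑-map-⊕ (h ++_) ((h ⊕ shift) ++_) (N r) ⟨
    ∑ (map (λ s → (h ++ s) ⊕ ((h ⊕ shift) ++ s)) (N r))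
      ≡⟨ cong ∑ (map-cong (flip-pair-sum h) (N r)) ⟩
    ∑ (map (λ _ → shift ++ 𝟘) (N r))
      ≡⟨ ∑-const-twice (shift ++ 𝟘) (N r) p (length-map-tailFlips (_$ r)) ⟩
    𝟘 ∎
    where
    open ≡-Reasoning
    N : Z2^ (twice p) → List (Z2^ (twice p))
    N = neighbours tailFlips
    flip-pair-sum : ∀ h s → (h ++ s) ⊕ ((h ⊕ shift) ++ s) ≡ shift ++ 𝟘
    flip-pair-sum h s =
      trans (zipWith-++ _xor_ h s (h ⊕ shift) s) (cong₂ _++_ (⊕-cancelˡ h shift) (⊕-self s))

  family-magic : Magic κ family
  family-magic = magic-++ {κ = κ} {flipPart} flipPart-magic
    (magic-⊗ {κ = κ} maps proj₁ (λ k → pairwise (proj₂ k) p)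
                     magicˡ (pairwise-magic {κ} maps proj₂ magicʳ p))

  head-walk : ∀ {h h′} → Walk (map proj₁ maps) h h′ → ∀ r → ∃[ r′ ] Walk family (h ++ r) (h′ ++ r′)
  head-walk ε r = r , ε
  head-walk {h} (s ◅ w) r
    with f , f∈ , refl ← ∈-map⁻ (_$ h) s
    with k , k∈ , refl ← ∈-map⁻ proj₁ f∈
    with r′ , w′ ← head-walk w (pairwise (proj₂ k) p r) =
    r′ , subst (Step family (h ++ r)) (⊗-++ (proj₁ k) (pairwise (proj₂ k) p) h r)
               (∈⇒step (h ++ r) (∈-++⁺ʳ flipPart (∈-map⁺ _ k∈))) ◅ w′

  tail-walk : ∀ h {r r′} → Walk tailFlips r r′ → Walk family (h ++ r) (h ++ r′)
  tail-walk h = walk-map (h ++_) λ {f} f∈ →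
    id ⊗ f , ∈-++⁺ˡ (∈-++⁺ˡ (∈-map⁺ (λ f → id ⊗ f) f∈)) , ⊗-++ id f h

  family-walks : ∀ v → Walk family v 𝟘
  family-walks = ∀-split λ h r →
    let r′ , w = head-walk (walks h) r in
    subst (Walk family (h ++ r)) (sym (𝟘-++ {j})) (w ◅◅ tail-walk 𝟘 (flips-walk r′))

  length-family : length family ≡ (twice p + twice p) + length maps
  length-family = begin
    length (flipPart ++ₗ productPart)
      ≡⟨ length-++ flipPart ⟩
    length flipPart + length productPart
      ≡⟨ cong₂ _+_ (length-++ (map (λ f → id ⊗ f) tailFlips))
                   (length-map (λ (α , β) → α ⊗ pairwise β p) maps) ⟩
    (length (map (λ f → id ⊗ f) tailFlips) + length (map (λ f → (_⊕ shift) ⊗ f) tailFlips)) +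
    length maps
      ≡⟨ cong (_+ length maps) (cong₂ _+_ (length-map-tailFlips (λ f → id ⊗ f))
                                          (length-map-tailFlips (λ f → (_⊕ shift) ⊗ f))) ⟩
    (twice p + twice p) + length maps ∎
    where open ≡-Reasoning

  open InvolutionGraph family family-involutive family-simple public using (graph)
  open InvolutionGraph family family-involutive family-simple using (degree-graph; xorMagic)

  graph-magic : XORMagic κ (j + twice p) graph
  graph-magic = xorMagic κ family-magic family-walks

  graph-regular : Regular ((twice p + twice p) + length maps) graph
  graph-regular x = trans (degree-graph x) length-family

-- The four heads

module _ {j} (κ : Nbhd) (maps : List ((Z2^ j → Z2^ j) × (Z2^ 2 → Z2^ 2))) (shift : Z2^ j)
         (depth : ℕ) where

  open import Data.List.Relation.Unary.Unique.DecPropositional (_≟_ {j}) using (unique?)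

  head? : Dec (All (λ (α , β) → Involutive _≡_ α × Involutive _≡_ β) maps ×
               (∀ h → Unique (h ∷ (h ⊕ shift) ∷ neighbours (map proj₁ maps) h)) ×
               Magic κ (map proj₁ maps) × Magic κ (map proj₂ maps) ×
               (∀ h → T (reachesWithin _≟_ (map proj₁ maps) 𝟘 depth h)))
  head? = All.all? (λ (α , β) → all? (λ h → α (α h) ≟ h) ×-dec all? (λ x → β (β x) ≟ x)) maps
    ×-dec all? (λ h → unique? _)
    ×-dec all? (λ h → (centre κ h ⊕ ∑ (neighbours (map proj₁ maps) h)) ≟ 𝟘)
    ×-dec all? (λ x → (centre κ x ⊕ ∑ (neighbours (map proj₂ maps) x)) ≟ 𝟘)
    ×-dec all? (λ h → T? _)

  mkHead : {True head?} → Head κ j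
  mkHead {ok} with involutive , separated , magicˡ , magicʳ , reaches ← toWitness ok = record
    { maps       = maps
    ; shift      = shift
    ; involutive = involutive
    ; separated  = separated
    ; magicˡ     = magicˡ
    ; magicʳ     = magicʳ
    ; walks      = λ h → reachesWithin-sound _≟_ (map proj₁ maps) 𝟘 depth h (reaches h)
    }

-- table T sends bits i to bits (T[i]); the entries are below 2 ^ j, so the mod is inert.
table : Vec ℕ (2 ^ j) → Z2^ j → Z2^ j
table {j} T h = bits (_mod_ (lookup T (index h)) (2 ^ j) ⦃ m^n≢0 2 j ⦄)

-- The involutions of GL₂(𝔽₂); their sum is zero.
swap₂ shear shear′ : Z2^ 2 → Z2^ 2
swap₂  (a ∷ b ∷ []) = b ∷ a ∷ []
shear  (a ∷ b ∷ []) = a ∷ (a xor b) ∷ []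
shear′ (a ∷ b ∷ []) = (a xor b) ∷ b ∷ []

closed₄ : Head closedN 4
closed₄ = mkHead closedN
  ( (table (8 ∷ 2 ∷ 1 ∷ 10 ∷ 14 ∷ 13 ∷ 11 ∷ 15 ∷ 0 ∷ 12 ∷ 3 ∷ 6 ∷ 9 ∷ 5 ∷ 4 ∷ 7 ∷ []) , id)
  ∷ (table (9 ∷ 5 ∷ 6 ∷ 8 ∷ 12 ∷ 1 ∷ 2 ∷ 10 ∷ 3 ∷ 0 ∷ 7 ∷ 14 ∷ 4 ∷ 15 ∷ 11 ∷ 13 ∷ []) , swap₂)
  ∷ (table (14 ∷ 8 ∷ 9 ∷ 12 ∷ 13 ∷ 15 ∷ 10 ∷ 11 ∷ 1 ∷ 2 ∷ 6 ∷ 7 ∷ 3 ∷ 4 ∷ 0 ∷ 5 ∷ []) , shear)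
  ∷ (table (15 ∷ 14 ∷ 12 ∷ 13 ∷ 11 ∷ 6 ∷ 5 ∷ 9 ∷ 10 ∷ 7 ∷ 8 ∷ 4 ∷ 2 ∷ 3 ∷ 1 ∷ 0 ∷ []) , shear′)
  ∷ [])
  (false ∷ false ∷ false ∷ true ∷ []) 3

open₄ : Head openN 4
open₄ = mkHead openN
  ( (table (4 ∷ 2 ∷ 1 ∷ 8 ∷ 0 ∷ 12 ∷ 15 ∷ 9 ∷ 3 ∷ 7 ∷ 14 ∷ 13 ∷ 5 ∷ 11 ∷ 10 ∷ 6 ∷ []) , id)
  ∷ (table (5 ∷ 4 ∷ 8 ∷ 9 ∷ 1 ∷ 0 ∷ 11 ∷ 15 ∷ 2 ∷ 3 ∷ 12 ∷ 6 ∷ 10 ∷ 14 ∷ 13 ∷ 7 ∷ []) , id)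
  ∷ (table (6 ∷ 7 ∷ 13 ∷ 15 ∷ 10 ∷ 8 ∷ 0 ∷ 1 ∷ 5 ∷ 12 ∷ 4 ∷ 14 ∷ 9 ∷ 2 ∷ 11 ∷ 3 ∷ []) , swap₂)
  ∷ (table (8 ∷ 12 ∷ 15 ∷ 4 ∷ 3 ∷ 10 ∷ 13 ∷ 11 ∷ 0 ∷ 14 ∷ 5 ∷ 7 ∷ 1 ∷ 6 ∷ 9 ∷ 2 ∷ []) , shear)
  ∷ (table (15 ∷ 13 ∷ 11 ∷ 10 ∷ 8 ∷ 14 ∷ 9 ∷ 12 ∷ 4 ∷ 6 ∷ 3 ∷ 2 ∷ 7 ∷ 1 ∷ 5 ∷ 0 ∷ []) , shear′)
  ∷ [])
  (false ∷ false ∷ false ∷ true ∷ []) 2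

closed₅ : Head closedN 5
closed₅ = mkHead closedN
  ( (table (3 ∷ 4 ∷ 8 ∷ 0 ∷ 1 ∷ 18 ∷ 16 ∷ 26 ∷ 2 ∷ 27 ∷ 12 ∷ 29 ∷ 10 ∷ 25 ∷ 22 ∷ 23
           ∷ 6 ∷ 20 ∷ 5 ∷ 30 ∷ 17 ∷ 31 ∷ 14 ∷ 15 ∷ 28 ∷ 13 ∷ 7 ∷ 9 ∷ 24 ∷ 11 ∷ 19 ∷ 21 ∷ []) , id)
  ∷ (table (7 ∷ 8 ∷ 11 ∷ 13 ∷ 17 ∷ 27 ∷ 24 ∷ 0 ∷ 1 ∷ 30 ∷ 29 ∷ 2 ∷ 19 ∷ 3 ∷ 31 ∷ 20
           ∷ 23 ∷ 4 ∷ 22 ∷ 12 ∷ 15 ∷ 25 ∷ 18 ∷ 16 ∷ 6 ∷ 21 ∷ 28 ∷ 5 ∷ 26 ∷ 10 ∷ 9 ∷ 14 ∷ []) , swap₂)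
  ∷ (table (18 ∷ 31 ∷ 26 ∷ 20 ∷ 7 ∷ 19 ∷ 25 ∷ 4 ∷ 30 ∷ 24 ∷ 22 ∷ 12 ∷ 11 ∷ 29 ∷ 23 ∷ 16
           ∷ 15 ∷ 28 ∷ 0 ∷ 5 ∷ 3 ∷ 27 ∷ 10 ∷ 14 ∷ 9 ∷ 6 ∷ 2 ∷ 21 ∷ 17 ∷ 13 ∷ 8 ∷ 1 ∷ []) , shear)
  ∷ (table (22 ∷ 18 ∷ 27 ∷ 26 ∷ 19 ∷ 31 ∷ 23 ∷ 25 ∷ 21 ∷ 20 ∷ 13 ∷ 24 ∷ 30 ∷ 10 ∷ 16 ∷ 28
           ∷ 14 ∷ 29 ∷ 1 ∷ 4 ∷ 9 ∷ 8 ∷ 0 ∷ 6 ∷ 11 ∷ 7 ∷ 3 ∷ 2 ∷ 15 ∷ 17 ∷ 12 ∷ 5 ∷ []) , shear′)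
  ∷ [])
  (false ∷ false ∷ false ∷ false ∷ true ∷ []) 4

open₅ : Head openN 5
open₅ = mkHead openN
  ( (table (14 ∷ 2 ∷ 1 ∷ 4 ∷ 3 ∷ 24 ∷ 11 ∷ 22 ∷ 29 ∷ 31 ∷ 20 ∷ 6 ∷ 16 ∷ 23 ∷ 0 ∷ 17
           ∷ 12 ∷ 15 ∷ 21 ∷ 26 ∷ 10 ∷ 18 ∷ 7 ∷ 13 ∷ 5 ∷ 28 ∷ 19 ∷ 30 ∷ 25 ∷ 8 ∷ 27 ∷ 9 ∷ []) , id)
  ∷ (table (17 ∷ 12 ∷ 5 ∷ 14 ∷ 7 ∷ 2 ∷ 19 ∷ 4 ∷ 30 ∷ 23 ∷ 16 ∷ 20 ∷ 1 ∷ 26 ∷ 3 ∷ 18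
           ∷ 10 ∷ 0 ∷ 15 ∷ 6 ∷ 11 ∷ 31 ∷ 25 ∷ 9 ∷ 29 ∷ 22 ∷ 13 ∷ 28 ∷ 27 ∷ 24 ∷ 8 ∷ 21 ∷ []) , id)
  ∷ (table (21 ∷ 13 ∷ 19 ∷ 12 ∷ 15 ∷ 25 ∷ 20 ∷ 28 ∷ 11 ∷ 27 ∷ 22 ∷ 8 ∷ 3 ∷ 1 ∷ 29 ∷ 4
           ∷ 18 ∷ 31 ∷ 16 ∷ 2 ∷ 6 ∷ 0 ∷ 10 ∷ 30 ∷ 26 ∷ 5 ∷ 24 ∷ 9 ∷ 7 ∷ 14 ∷ 23 ∷ 17 ∷ []) , swap₂)
  ∷ (table (22 ∷ 24 ∷ 13 ∷ 30 ∷ 26 ∷ 28 ∷ 21 ∷ 16 ∷ 31 ∷ 25 ∷ 27 ∷ 15 ∷ 29 ∷ 2 ∷ 19 ∷ 11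
           ∷ 7 ∷ 20 ∷ 23 ∷ 14 ∷ 17 ∷ 6 ∷ 0 ∷ 18 ∷ 1 ∷ 9 ∷ 4 ∷ 10 ∷ 5 ∷ 12 ∷ 3 ∷ 8 ∷ []) , shear)
  ∷ (table (28 ∷ 27 ∷ 26 ∷ 24 ∷ 17 ∷ 31 ∷ 25 ∷ 30 ∷ 23 ∷ 10 ∷ 9 ∷ 21 ∷ 15 ∷ 14 ∷ 13 ∷ 12
           ∷ 19 ∷ 4 ∷ 29 ∷ 16 ∷ 22 ∷ 11 ∷ 20 ∷ 8 ∷ 3 ∷ 6 ∷ 2 ∷ 1 ∷ 0 ∷ 18 ∷ 7 ∷ 5 ∷ []) , shear′)
  ∷ [])
  (false ∷ false ∷ false ∷ false ∷ true ∷ []) 3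

even-regular-closed-magic : ∀ {j} (H : Head closedN j) → 2 ∣ length (Head.maps H) → ∀ p →
  Σ (Graph (2 ^ (j + twice p))) λ G →
    ClosedXORMagic (j + twice p) G × Σ ℕ (λ k → 2 ∣ k × Regular k G)
even-regular-closed-magic H 2∣maps p =
  graph , graph-magic , _ , ∣m∣n⇒∣m+n (2∣twice+twice p) 2∣maps , graph-regular
  where open Construction H p

odd-regular-open-magic : ∀ {j} (H : Head openN j) → ¬ 2 ∣ length (Head.maps H) → ∀ p →
  Σ (Graph (2 ^ (j + twice p))) λ G →
    OpenXORMagic (j + twice p) G × Σ ℕ (λ k → ¬ 2 ∣ k × Regular k G)
odd-regular-open-magic H 2∤maps p =
  graph , graph-magic , _ , (λ 2∣k → 2∤maps (∣m+n∣m⇒∣n 2∣k (2∣twice+twice p))) , graph-regular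
  where open Construction H p

data Parity : ℕ → Set where
  even : ∀ p → Parity (twice p)
  odd  : ∀ p → Parity (suc (twice p))

parity : ∀ m → Parity m
parity zero = even zero
parity (suc m) with parity m
... | even p = odd p
... | odd  p = even (suc p)

theorem2 : (n : ℕ) → 3 < n →
    Σ (Graph (2 ^ n)) (λ G → ClosedXORMagic n G × Σ ℕ (λ k → 2 ∣ k × Regular k G))
    × Σ (Graph (2 ^ n)) (λ G → OpenXORMagic n G × Σ ℕ (λ k → ¬ (2 ∣ k) × Regular k G))
theorem2 .(suc (suc (suc (suc m)))) (s≤s (s≤s (s≤s (s≤s {n = m} z≤n)))) with parity m
... | even p = even-regular-closed-magic closed₄ (divides 2 refl) p ,
               odd-regular-open-magic open₄ (from-no (2 ∣? 5)) p
... | odd  p = even-regular-closed-magic closed₅ (divides 2 refl) p ,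
               odd-regular-open-magic open₅ (from-no (2 ∣? 5)) p
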